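{- Let $A$ be a finite abelian group with at least $3$ elements and let $S_1,\ldots,S_k$ be a distinct difference system in $A$. Call a subset of $A$ a basis if it consists of $3$ elements and is not a translate of a subset of any $S_i$. Then these bases define a simple rank $3$ matroid on $A$ that is $A$-invariant (every translate of a basis is a basis).
   Context: Subsets $S_1,\ldots,S_k$ of an abelian group $A$ form a distinct difference system if: (i) for any $i,j$ and any $x,y\in S_i$, $z,w\in S_j$ with $x\neq y$ and $z\neq w$, the equation $x-y=z-w$ implies $x=z$ and $y=w$; (ii) each $S_i$ contains $0$ and at least one other element; (iii) $S_i\cap S_j=\{0\}$ for all $i\neq j$. A translate of $T\subseteq A$ is $\{t+a\mid t\in T\}$ for some $a\in A$. A matroid is simple if every circuit has at least three elements. -}

module Defs where

open import Data.Nat using (ℕ; _≤_)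
open import Data.Fin using (Fin)
open import Data.Fin.Subset using (Subset; _∈_; _∉_; _⊆_; _⊂_; _∪_; _-_; ⁅_⁆; ∣_∣)
open import Data.Product using (Σ; ∃; _×_; _,_)
open import Relation.Binary.PropositionalEquality using (_≡_; _≢_)
open import Relation.Nullary using (¬_)
open import Function.Bundles using (_⇔_)
open import Algebra.Core using (Op₁; Op₂)
open import Algebra.Structures using (IsAbelianGroup)

-- A finite abelian group of order n, presented on the carrier Fin n
-- (every finite abelian group is isomorphic to one of this form).
record FinAbGroup (n : ℕ) : Set where
  infixl 6 _+_
  field
    _+_ : Op₂ (Fin n)
    0#  : Fin n
    neg : Op₁ (Fin n)
    isAbelianGroup : IsAbelianGroup _≡_ _+_ 0# neg

module _ {n : ℕ} (G : FinAbGroup n) where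
  open FinAbGroup G

  IsTranslateOf : Subset n → Subset n → Set
  IsTranslateOf B T = ∃ λ a → ∀ x → (x ∈ B) ⇔ (∃ λ t → t ∈ T × x ≡ t + a)

  IsDDS : {k : ℕ} → (Fin k → Subset n) → Set
  IsDDS {k} S =
      (∀ i j x y z w → x ∈ S i → y ∈ S i → z ∈ S j → w ∈ S j →
         x ≢ y → z ≢ w → x + neg y ≡ z + neg w → (x ≡ z × y ≡ w))
    × (∀ i → 0# ∈ S i × (∃ λ x → x ∈ S i × x ≢ 0#))
    × (∀ i j → i ≢ j → ∀ x → x ∈ S i → x ∈ S j → x ≡ 0#)

  DDSBasis : {k : ℕ} → (Fin k → Subset n) → Subset n → Set
  DDSBasis S B = ∣ B ∣ ≡ 3 × ¬ (∃ λ i → ∃ λ T → T ⊆ S i × IsTranslateOf B T)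

  IsInvariant : (Subset n → Set) → Set
  IsInvariant ℬ = ∀ B B' → ℬ B → IsTranslateOf B' B → ℬ B'

module _ {n : ℕ} (ℬ : Subset n → Set) where

  IsMatroidBases : Set
  IsMatroidBases =
      (∃ λ B → ℬ B)
    × (∀ B₁ B₂ → ℬ B₁ → ℬ B₂ → ∀ x → x ∈ B₁ → x ∉ B₂ →
         ∃ λ y → y ∈ B₂ × y ∉ B₁ × ℬ ((B₁ - x) ∪ ⁅ y ⁆))

  Independent : Subset n → Set
  Independent I = ∃ λ B → ℬ B × I ⊆ B

  Dependent : Subset n → Set
  Dependent D = ¬ Independent D

  IsCircuit : Subset n → Set
  IsCircuit C = Dependent C × (∀ D → D ⊂ C → Independent D)

  HasRank : ℕ → Set
  HasRank r = ∀ B → ℬ B → ∣ B ∣ ≡ r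

  IsSimple : Set
  IsSimple = ∀ C → IsCircuit C → 3 ≤ ∣ C ∣

{-# OPTIONS --safe #-}
-- Call the translates a + S i lines.  Two distinct points p, q lie on at most one line, since
-- otherwise p - q would be represented as a difference in two ways; and no line is all of A,
-- since d - 0 = 0 - (-d) for d ≠ 0.  A 3-set is a basis exactly when it lies on no line.
-- For the exchange property write B₁ = {x, p, q}: if p, q lie on a line, then some y ∈ B₂ is
-- off it, as B₂ lies on no line; otherwise any y ∈ B₂ other than p, q works.  Extending every
-- pair to a basis the same way (inside A) shows that no circuit has fewer than three points,
-- and translation maps lines to lines.
module Submission where

open import Level using (0ℓ)
open import Algebra.Bundles using (Group)
open import Algebra.Structures using (IsAbelianGroup)
open import Data.Nat as ℕ using (ℕ; suc; _≤_; _<_; z≤n; s≤s)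
open import Data.Nat.Properties
  using (≤-reflexive; ≤-trans; ≤-antisym; +-suc; +-monoʳ-≤; n≤1+n; <⇒≱; ≰⇒>; _≤?_)
open import Data.Fin using (Fin)
open import Data.Fin.Properties using (_≟_; any?)
open import Data.Fin.Subset
open import Data.Fin.Subset.Properties
open import Data.Vec.Base using (_∷_; []; lookup; tabulate)
open import Data.Vec.Properties using ([]=⇒lookup; lookup⇒[]=; lookup∘tabulate)
open import Data.Product using (∃; ∃₂; _×_; _,_; proj₁; proj₂)
open import Data.Sum using (_⊎_; inj₁; inj₂; [_,_]; map)
open import Function.Base using (_∘_)
open import Function.Bundles using (_⇔_; mk⇔; Equivalence)
open import Relation.Binary.PropositionalEquality
  using (_≡_; _≢_; refl; sym; trans; cong; subst; subst₂; ≢-sym; module ≡-Reasoning)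
open import Relation.Nullary using (¬_; Dec; yes; no; contradiction)
open import Relation.Nullary.Decidable using (_×-dec_; ¬?; decidable-stable)
open import Relation.Unary using (Pred; Decidable)
open import Defs

module _ {a ℓ} (G : Group a ℓ) where
  open Group G
  open import Algebra.Properties.Group G using (\\-leftDividesˡ; ⁻¹-anti-homo-∙)
  open import Relation.Binary.Reasoning.Setoid setoid

  x∙z//y∙z≈x//y : ∀ x y z → (x ∙ z) // (y ∙ z) ≈ x // y
  x∙z//y∙z≈x//y x y z = begin
    (x ∙ z) ∙ (y ∙ z) ⁻¹    ≈⟨ ∙-congˡ (⁻¹-anti-homo-∙ y z) ⟩
    (x ∙ z) ∙ (z ⁻¹ ∙ y ⁻¹) ≈⟨ assoc x z (z ⁻¹ ∙ y ⁻¹) ⟩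
    x ∙ (z ∙ (z ⁻¹ ∙ y ⁻¹)) ≈⟨ ∙-congˡ (\\-leftDividesˡ z (y ⁻¹)) ⟩
    x ∙ y ⁻¹                ∎

group : ∀ {n} → FinAbGroup n → Group 0ℓ 0ℓ
group G = record { isGroup = IsAbelianGroup.isGroup (FinAbGroup.isAbelianGroup G) }

∣p∪q∣≤∣p∣+∣q∣ : ∀ {n} (p q : Subset n) → ∣ p ∪ q ∣ ≤ ∣ p ∣ ℕ.+ ∣ q ∣
∣p∪q∣≤∣p∣+∣q∣ []            []            = z≤n
∣p∪q∣≤∣p∣+∣q∣ (outside ∷ p) (outside ∷ q) = ∣p∪q∣≤∣p∣+∣q∣ p q
∣p∪q∣≤∣p∣+∣q∣ (outside ∷ p) (inside ∷ q)  =
  ≤-trans (s≤s (∣p∪q∣≤∣p∣+∣q∣ p q)) (≤-reflexive (sym (+-suc ∣ p ∣ ∣ q ∣)))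
∣p∪q∣≤∣p∣+∣q∣ (inside ∷ p)  (outside ∷ q) = s≤s (∣p∪q∣≤∣p∣+∣q∣ p q)
∣p∪q∣≤∣p∣+∣q∣ (inside ∷ p)  (inside ∷ q)  =
  s≤s (≤-trans (∣p∪q∣≤∣p∣+∣q∣ p q) (+-monoʳ-≤ ∣ p ∣ (n≤1+n ∣ q ∣)))

preimage : ∀ {m n} → (Fin m → Fin n) → Subset n → Subset m
preimage f p = tabulate (lookup p ∘ f)

x∈preimage⁺ : ∀ {m n} {f : Fin m → Fin n} {p x} → f x ∈ p → x ∈ preimage f p
x∈preimage⁺ {f = f} {p} {x} fx∈p =
  lookup⇒[]= x (preimage f p) (trans (lookup∘tabulate (lookup p ∘ f) x) ([]=⇒lookup fx∈p))

x∈preimage⁻ : ∀ {m n} {f : Fin m → Fin n} {p x} → x ∈ preimage f p → f x ∈ p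
x∈preimage⁻ {f = f} {p} {x} x∈ =
  lookup⇒[]= (f x) p (trans (sym (lookup∘tabulate (lookup p ∘ f) x)) ([]=⇒lookup x∈))

module _ {n : ℕ} where

  ∀∈⊎∃∈¬ : ∀ {ℓ} {P : Pred (Fin n) ℓ} → Decidable P → ∀ (p : Subset n) →
           (∀ {x} → x ∈ p → P x) ⊎ ∃ λ x → x ∈ p × ¬ P x
  ∀∈⊎∃∈¬ P? p with any? (λ x → x ∈? p ×-dec ¬? (P? x))
  ... | yes counterexample = inj₂ counterexample
  ... | no none = inj₁ λ {x} x∈p → decidable-stable (P? x) (λ ¬Px → none (x , x∈p , ¬Px))

  ∣p∣<∣q∣⇒∃x∈q∧x∉p : ∀ (p q : Subset n) → ∣ p ∣ < ∣ q ∣ → ∃ λ x → x ∈ q × x ∉ p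
  ∣p∣<∣q∣⇒∃x∈q∧x∉p p q ∣p∣<∣q∣ with ∀∈⊎∃∈¬ (_∈? p) q
  ... | inj₁ q⊆p = contradiction (p⊆q⇒∣p∣≤∣q∣ q⊆p) (<⇒≱ ∣p∣<∣q∣)
  ... | inj₂ witness = witness

  p⊆q∧∣q∣≤∣p∣⇒p≡q : ∀ {p q : Subset n} → p ⊆ q → ∣ q ∣ ≤ ∣ p ∣ → p ≡ q
  p⊆q∧∣q∣≤∣p∣⇒p≡q {p} {q} p⊆q ∣q∣≤∣p∣ = ⊆-antisym p⊆q q⊆p
    where
      q⊆p : q ⊆ p
      q⊆p {x} x∈q = decidable-stable (x ∈? p) λ x∉p →
        <⇒≱ (p⊂q⇒∣p∣<∣q∣ (p⊆q , x , x∈q , x∉p)) ∣q∣≤∣p∣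

  ⁅x⁆⊆p : ∀ {x} {p : Subset n} → x ∈ p → ⁅ x ⁆ ⊆ p
  ⁅x⁆⊆p {x} {p} x∈p y∈⁅x⁆ = subst (_∈ p) (sym (x∈⁅y⁆⇒x≡y x y∈⁅x⁆)) x∈p

  ⁅x⁆∪p⊆q : ∀ {x} {p q : Subset n} → x ∈ q → p ⊆ q → ⁅ x ⁆ ∪ p ⊆ q
  ⁅x⁆∪p⊆q {x} {p} x∈q p⊆q = [ ⁅x⁆⊆p x∈q , p⊆q ] ∘ x∈p∪q⁻ ⁅ x ⁆ p

  x∈⁅y⁆∪⁅z⁆⁺ : ∀ {x y z : Fin n} → x ≡ y ⊎ x ≡ z → x ∈ ⁅ y ⁆ ∪ ⁅ z ⁆
  x∈⁅y⁆∪⁅z⁆⁺ (inj₁ refl) = x∈p∪q⁺ (inj₁ (x∈⁅x⁆ _))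
  x∈⁅y⁆∪⁅z⁆⁺ (inj₂ refl) = x∈p∪q⁺ (inj₂ (x∈⁅x⁆ _))

  x∈⁅y⁆∪⁅z⁆⁻ : ∀ {x : Fin n} y z → x ∈ ⁅ y ⁆ ∪ ⁅ z ⁆ → x ≡ y ⊎ x ≡ z
  x∈⁅y⁆∪⁅z⁆⁻ y z = map (x∈⁅y⁆⇒x≡y y) (x∈⁅y⁆⇒x≡y z) ∘ x∈p∪q⁻ ⁅ y ⁆ ⁅ z ⁆

  x∈⁅y⁆∪⁅z⁆∪⁅w⁆⁺ : ∀ {x y z w : Fin n} → x ≡ y ⊎ x ≡ z ⊎ x ≡ w → x ∈ ⁅ y ⁆ ∪ ⁅ z ⁆ ∪ ⁅ w ⁆
  x∈⁅y⁆∪⁅z⁆∪⁅w⁆⁺ (inj₁ refl) = x∈p∪q⁺ (inj₁ (x∈⁅x⁆ _))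
  x∈⁅y⁆∪⁅z⁆∪⁅w⁆⁺ (inj₂ x≡z⊎x≡w) = x∈p∪q⁺ (inj₂ (x∈⁅y⁆∪⁅z⁆⁺ x≡z⊎x≡w))

  x∈⁅y⁆∪⁅z⁆∪⁅w⁆⁻ : ∀ {x : Fin n} y z w → x ∈ ⁅ y ⁆ ∪ ⁅ z ⁆ ∪ ⁅ w ⁆ → x ≡ y ⊎ x ≡ z ⊎ x ≡ w
  x∈⁅y⁆∪⁅z⁆∪⁅w⁆⁻ y z w = map (x∈⁅y⁆⇒x≡y y) (x∈⁅y⁆∪⁅z⁆⁻ z w) ∘ x∈p∪q⁻ ⁅ y ⁆ (⁅ z ⁆ ∪ ⁅ w ⁆)

  x∈⁅x⁆∪⁅y⁆∪⁅z⁆ : ∀ {x y z : Fin n} → x ∈ ⁅ x ⁆ ∪ ⁅ y ⁆ ∪ ⁅ z ⁆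
  x∈⁅x⁆∪⁅y⁆∪⁅z⁆ = x∈⁅y⁆∪⁅z⁆∪⁅w⁆⁺ (inj₁ refl)

  y∈⁅x⁆∪⁅y⁆∪⁅z⁆ : ∀ {x y z : Fin n} → y ∈ ⁅ x ⁆ ∪ ⁅ y ⁆ ∪ ⁅ z ⁆
  y∈⁅x⁆∪⁅y⁆∪⁅z⁆ = x∈⁅y⁆∪⁅z⁆∪⁅w⁆⁺ (inj₂ (inj₁ refl))

  z∈⁅x⁆∪⁅y⁆∪⁅z⁆ : ∀ {x y z : Fin n} → z ∈ ⁅ x ⁆ ∪ ⁅ y ⁆ ∪ ⁅ z ⁆
  z∈⁅x⁆∪⁅y⁆∪⁅z⁆ = x∈⁅y⁆∪⁅z⁆∪⁅w⁆⁺ (inj₂ (inj₂ refl))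

  ⁅x⁆∪⁅y⁆∪⁅z⁆⊆p : ∀ {x y z} {p : Subset n} → x ∈ p → y ∈ p → z ∈ p → ⁅ x ⁆ ∪ ⁅ y ⁆ ∪ ⁅ z ⁆ ⊆ p
  ⁅x⁆∪⁅y⁆∪⁅z⁆⊆p x∈p y∈p z∈p = ⁅x⁆∪p⊆q x∈p (⁅x⁆∪p⊆q y∈p (⁅x⁆⊆p z∈p))

  ∣⁅x⁆∪p∣≤1+∣p∣ : ∀ (x : Fin n) p → ∣ ⁅ x ⁆ ∪ p ∣ ≤ suc ∣ p ∣
  ∣⁅x⁆∪p∣≤1+∣p∣ x p = ≤-trans (∣p∪q∣≤∣p∣+∣q∣ ⁅ x ⁆ p) (≤-reflexive (cong (ℕ._+ ∣ p ∣) (∣⁅x⁆∣≡1 x)))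

  ∣p∣<∣⁅x⁆∪p∣ : ∀ {x : Fin n} {p} → x ∉ p → ∣ p ∣ < ∣ ⁅ x ⁆ ∪ p ∣
  ∣p∣<∣⁅x⁆∪p∣ {x} {p} x∉p = p⊂q⇒∣p∣<∣q∣ (q⊆p∪q ⁅ x ⁆ p , x , x∈p∪q⁺ (inj₁ (x∈⁅x⁆ x)) , x∉p)

  ∣⁅x⁆∪⁅y⁆∣≤2 : ∀ (x y : Fin n) → ∣ ⁅ x ⁆ ∪ ⁅ y ⁆ ∣ ≤ 2
  ∣⁅x⁆∪⁅y⁆∣≤2 x y = ≤-trans (∣⁅x⁆∪p∣≤1+∣p∣ x ⁅ y ⁆) (s≤s (≤-reflexive (∣⁅x⁆∣≡1 y)))

  ∣p-x∪⁅y⁆∣≤∣p∣ : ∀ {x : Fin n} {p} y → x ∈ p → ∣ (p - x) ∪ ⁅ y ⁆ ∣ ≤ ∣ p ∣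
  ∣p-x∪⁅y⁆∣≤∣p∣ {x} {p} y x∈p = ≤-trans ∣p-x∪⁅y⁆∣≤1+∣p-x∣ (x∈p⇒∣p-x∣<∣p∣ x∈p)
    where
      ∣p-x∪⁅y⁆∣≤1+∣p-x∣ : ∣ (p - x) ∪ ⁅ y ⁆ ∣ ≤ suc ∣ p - x ∣
      ∣p-x∪⁅y⁆∣≤1+∣p-x∣ = subst (λ r → ∣ r ∣ ≤ suc ∣ p - x ∣) (∪-comm ⁅ y ⁆ (p - x)) (∣⁅x⁆∪p∣≤1+∣p∣ y (p - x))

  Distinct₃ : Fin n → Fin n → Fin n → Set
  Distinct₃ x y z = x ≢ y × x ≢ z × y ≢ z

  y∉⁅x⁆∧z∉⁅x⁆∪⁅y⁆⇒Distinct₃ : ∀ {x y z} → y ∉ ⁅ x ⁆ → z ∉ ⁅ x ⁆ ∪ ⁅ y ⁆ → Distinct₃ x y z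
  y∉⁅x⁆∧z∉⁅x⁆∪⁅y⁆⇒Distinct₃ y∉⁅x⁆ z∉⁅x⁆∪⁅y⁆ =
    ≢-sym (x∉⁅y⁆⇒x≢y y∉⁅x⁆) , ≢-sym (z∉⁅x⁆∪⁅y⁆ ∘ x∈⁅y⁆∪⁅z⁆⁺ ∘ inj₁) , ≢-sym (z∉⁅x⁆∪⁅y⁆ ∘ x∈⁅y⁆∪⁅z⁆⁺ ∘ inj₂)

  ∣⁅x⁆∪⁅y⁆∪⁅z⁆∣≡3 : ∀ {x y z : Fin n} → Distinct₃ x y z → ∣ ⁅ x ⁆ ∪ ⁅ y ⁆ ∪ ⁅ z ⁆ ∣ ≡ 3
  ∣⁅x⁆∪⁅y⁆∪⁅z⁆∣≡3 {x} {y} {z} (x≢y , x≢z , y≢z) = ≤-antisym upper lower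
    where
      upper : ∣ ⁅ x ⁆ ∪ ⁅ y ⁆ ∪ ⁅ z ⁆ ∣ ≤ 3
      upper = ≤-trans (∣⁅x⁆∪p∣≤1+∣p∣ x (⁅ y ⁆ ∪ ⁅ z ⁆)) (s≤s (∣⁅x⁆∪⁅y⁆∣≤2 y z))
      1<∣⁅y⁆∪⁅z⁆∣ : 1 < ∣ ⁅ y ⁆ ∪ ⁅ z ⁆ ∣
      1<∣⁅y⁆∪⁅z⁆∣ = subst (_< ∣ ⁅ y ⁆ ∪ ⁅ z ⁆ ∣) (∣⁅x⁆∣≡1 z) (∣p∣<∣⁅x⁆∪p∣ (x≢y⇒x∉⁅y⁆ y≢z))
      lower : 3 ≤ ∣ ⁅ x ⁆ ∪ ⁅ y ⁆ ∪ ⁅ z ⁆ ∣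
      lower = ≤-trans (s≤s 1<∣⁅y⁆∪⁅z⁆∣) (∣p∣<∣⁅x⁆∪p∣ ([ x≢y , x≢z ] ∘ x∈⁅y⁆∪⁅z⁆⁻ y z))

  ∃-∉⁅x⁆∪⁅y⁆ : ∀ {p : Subset n} → 3 ≤ ∣ p ∣ → ∀ x y → ∃ λ z → z ∈ p × z ≢ x × z ≢ y
  ∃-∉⁅x⁆∪⁅y⁆ {p} 3≤∣p∣ x y
    with ∣p∣<∣q∣⇒∃x∈q∧x∉p (⁅ x ⁆ ∪ ⁅ y ⁆) p (≤-trans (s≤s (∣⁅x⁆∪⁅y⁆∣≤2 x y)) 3≤∣p∣)
  ... | z , z∈p , z∉⁅x⁆∪⁅y⁆ = z , z∈p , z∉⁅x⁆∪⁅y⁆ ∘ x∈⁅y⁆∪⁅z⁆⁺ ∘ inj₁ , z∉⁅x⁆∪⁅y⁆ ∘ x∈⁅y⁆∪⁅z⁆⁺ ∘ inj₂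

  x∈p∧∣p∣≡3⇒≡⁅x⁆∪⁅y⁆∪⁅z⁆ : ∀ {x} {p : Subset n} → x ∈ p → ∣ p ∣ ≡ 3 →
                            ∃₂ λ y z → Distinct₃ x y z × p ≡ ⁅ x ⁆ ∪ ⁅ y ⁆ ∪ ⁅ z ⁆
  x∈p∧∣p∣≡3⇒≡⁅x⁆∪⁅y⁆∪⁅z⁆ {x} {p} x∈p ∣p∣≡3
    with ∣p∣<∣q∣⇒∃x∈q∧x∉p ⁅ x ⁆ p (subst₂ _<_ (sym (∣⁅x⁆∣≡1 x)) (sym ∣p∣≡3) (s≤s (s≤s z≤n)))
  ... | y , y∈p , y∉⁅x⁆
    with ∣p∣<∣q∣⇒∃x∈q∧x∉p (⁅ x ⁆ ∪ ⁅ y ⁆) p (≤-trans (s≤s (∣⁅x⁆∪⁅y⁆∣≤2 x y)) (≤-reflexive (sym ∣p∣≡3)))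
  ... | z , z∈p , z∉⁅x⁆∪⁅y⁆ =
    y , z , distinct , sym (p⊆q∧∣q∣≤∣p∣⇒p≡q (⁅x⁆∪⁅y⁆∪⁅z⁆⊆p x∈p y∈p z∈p) ∣p∣≤3)
    where
      distinct : Distinct₃ x y z
      distinct = y∉⁅x⁆∧z∉⁅x⁆∪⁅y⁆⇒Distinct₃ y∉⁅x⁆ z∉⁅x⁆∪⁅y⁆
      ∣p∣≤3 : ∣ p ∣ ≤ ∣ ⁅ x ⁆ ∪ ⁅ y ⁆ ∪ ⁅ z ⁆ ∣
      ∣p∣≤3 = ≤-reflexive (trans ∣p∣≡3 (sym (∣⁅x⁆∪⁅y⁆∪⁅z⁆∣≡3 distinct)))

  ∣p∣≡3⇒≡⁅x⁆∪⁅y⁆∪⁅z⁆ : ∀ {p : Subset n} → ∣ p ∣ ≡ 3 →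
                       ∃ λ x → ∃₂ λ y z → Distinct₃ x y z × p ≡ ⁅ x ⁆ ∪ ⁅ y ⁆ ∪ ⁅ z ⁆
  ∣p∣≡3⇒≡⁅x⁆∪⁅y⁆∪⁅z⁆ {p} ∣p∣≡3
    with ∣p∣<∣q∣⇒∃x∈q∧x∉p ⊥ p (subst₂ _<_ (sym (∣⊥∣≡0 n)) (sym ∣p∣≡3) (s≤s z≤n))
  ... | x , x∈p , _ = x , x∈p∧∣p∣≡3⇒≡⁅x⁆∪⁅y⁆∪⁅z⁆ x∈p ∣p∣≡3

  ∣p∣<3⇒⊆⁅x⁆∪⁅y⁆ : ∀ {p : Subset n} → Fin n → ∣ p ∣ < 3 → ∃₂ λ x y → p ⊆ ⁅ x ⁆ ∪ ⁅ y ⁆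
  ∣p∣<3⇒⊆⁅x⁆∪⁅y⁆ {p} d ∣p∣<3 with ∀∈⊎∃∈¬ (_∈? ⊥) p
  ... | inj₁ p⊆⊥ = d , d , ⊆-trans p⊆⊥ ⊥⊆
  ... | inj₂ (x , x∈p , _) with ∀∈⊎∃∈¬ (_∈? ⁅ x ⁆) p
  ...   | inj₁ p⊆⁅x⁆ = x , x , ⊆-trans p⊆⁅x⁆ (p⊆p∪q ⁅ x ⁆)
  ...   | inj₂ (y , y∈p , y∉⁅x⁆) with ∀∈⊎∃∈¬ (_∈? ⁅ x ⁆ ∪ ⁅ y ⁆) p
  ...     | inj₁ p⊆⁅x⁆∪⁅y⁆ = x , y , p⊆⁅x⁆∪⁅y⁆
  ...     | inj₂ (z , z∈p , z∉⁅x⁆∪⁅y⁆) = contradiction 3≤∣p∣ (<⇒≱ ∣p∣<3)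
    where
      3≤∣p∣ : 3 ≤ ∣ p ∣
      3≤∣p∣ = subst (_≤ ∣ p ∣) (∣⁅x⁆∪⁅y⁆∪⁅z⁆∣≡3 (y∉⁅x⁆∧z∉⁅x⁆∪⁅y⁆⇒Distinct₃ y∉⁅x⁆ z∉⁅x⁆∪⁅y⁆))
                (p⊆q⇒∣p∣≤∣q∣ (⁅x⁆∪⁅y⁆∪⁅z⁆⊆p x∈p y∈p z∈p))

  image-⁅x⁆∪⁅y⁆∪⁅z⁆ : ∀ {x y z} {p : Subset n} (f : Fin n → Fin n) →
    (∀ w → (w ∈ p) ⇔ (∃ λ t → t ∈ ⁅ x ⁆ ∪ ⁅ y ⁆ ∪ ⁅ z ⁆ × w ≡ f t)) →
    p ≡ ⁅ f x ⁆ ∪ ⁅ f y ⁆ ∪ ⁅ f z ⁆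
  image-⁅x⁆∪⁅y⁆∪⁅z⁆ {x} {y} {z} {p} f p≈image = ⊆-antisym p⊆image image⊆p
    where
      p⊆image : p ⊆ ⁅ f x ⁆ ∪ ⁅ f y ⁆ ∪ ⁅ f z ⁆
      p⊆image {w} w∈p with Equivalence.to (p≈image w) w∈p
      ... | t , t∈T , refl = x∈⁅y⁆∪⁅z⁆∪⁅w⁆⁺ (map (cong f) (map (cong f) (cong f)) (x∈⁅y⁆∪⁅z⁆∪⁅w⁆⁻ x y z t∈T))
      f[_]∈p : ∀ {t} → t ∈ ⁅ x ⁆ ∪ ⁅ y ⁆ ∪ ⁅ z ⁆ → f t ∈ p
      f[ t∈T ]∈p = Equivalence.from (p≈image _) (_ , t∈T , refl)
      image⊆p : ⁅ f x ⁆ ∪ ⁅ f y ⁆ ∪ ⁅ f z ⁆ ⊆ p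
      image⊆p = ⁅x⁆∪⁅y⁆∪⁅z⁆⊆p f[ x∈⁅x⁆∪⁅y⁆∪⁅z⁆ ]∈p f[ y∈⁅x⁆∪⁅y⁆∪⁅z⁆ ]∈p f[ z∈⁅x⁆∪⁅y⁆∪⁅z⁆ ]∈p

module DDSMatroid {n : ℕ} (G : FinAbGroup n) {k : ℕ} {S : Fin k → Subset n} (dds : IsDDS G S) where
  open FinAbGroup G using (_+_; 0#; neg)
  open Group (group G) using (_//_; identityˡ; identityʳ)
  open import Algebra.Properties.Group (group G)
    using (∙-cancelˡ; ∙-cancelʳ; ⁻¹-injective; ⁻¹-involutive; ε⁻¹≈ε; //-rightDividesˡ; //-rightDividesʳ)
  open ≡-Reasoning

  OnLine : Fin k → Fin n → Fin n → Set
  OnLine i a x = x // a ∈ S i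

  OnLine? : ∀ i a x → Dec (OnLine i a x)
  OnLine? i a x = x // a ∈? S i

  Collinear : Subset n → Set
  Collinear B = ∃₂ λ i a → ∀ {x} → x ∈ B → OnLine i a x

  Basis : Subset n → Set
  Basis = DDSBasis G S

  line-unique : ∀ {i j a b p q} → p ≢ q →
                OnLine i a p → OnLine i a q → OnLine j b p → OnLine j b q → i ≡ j × a ≡ b
  line-unique {i} {j} {a} {b} {p} {q} p≢q p∈ℓ q∈ℓ p∈ℓ′ q∈ℓ′ = i≡j , a≡b
    where
      same-representation : p // a ≡ p // b × q // a ≡ q // b
      same-representation =
        proj₁ dds i j (p // a) (q // a) (p // b) (q // b) p∈ℓ q∈ℓ p∈ℓ′ q∈ℓ′
          (p≢q ∘ ∙-cancelʳ (neg a) p q) (p≢q ∘ ∙-cancelʳ (neg b) p q)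
          (trans (x∙z//y∙z≈x//y (group G) p q (neg a)) (sym (x∙z//y∙z≈x//y (group G) p q (neg b))))
      a≡b : a ≡ b
      a≡b = ⁻¹-injective (∙-cancelˡ p (neg a) (neg b) (proj₁ same-representation))
      i≡j : i ≡ j
      i≡j with i ≟ j
      ... | yes i≡j = i≡j
      ... | no i≢j = contradiction (∙-cancelʳ (neg a) p q (trans (p//a≡0) (sym q//a≡0))) p≢q
        where
          p//a≡0 : p // a ≡ 0#
          p//a≡0 = proj₂ (proj₂ dds) i j i≢j (p // a) p∈ℓ
                     (subst (_∈ S j) (sym (proj₁ same-representation)) p∈ℓ′)
          q//a≡0 : q // a ≡ 0#
          q//a≡0 = proj₂ (proj₂ dds) i j i≢j (q // a) q∈ℓ
                     (subst (_∈ S j) (sym (proj₂ same-representation)) q∈ℓ′)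

  S-not-full : ∀ {d} → d ≢ 0# → ∀ i → ¬ (∀ x → x ∈ S i)
  S-not-full {d} d≢0 i full =
    d≢0 (proj₁ (proj₁ dds i i d 0# 0# (neg d) (full _) (full _) (full _) (full _) d≢0 0≢-d d-0≡0-[-d]))
    where
      0≢-d : 0# ≢ neg d
      0≢-d 0≡-d = d≢0 (⁻¹-injective (trans (sym 0≡-d) (sym ε⁻¹≈ε)))
      d-0≡0-[-d] : d // 0# ≡ 0# // neg d
      d-0≡0-[-d] = begin
        d // 0#          ≡⟨ cong (d +_) ε⁻¹≈ε ⟩
        d + 0#           ≡⟨ identityʳ d ⟩
        d                ≡⟨ ⁻¹-involutive d ⟨
        neg (neg d)      ≡⟨ identityˡ (neg (neg d)) ⟨
        0# + neg (neg d) ∎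

  ¬collinear-⊤ : 1 < n → ¬ Collinear ⊤
  ¬collinear-⊤ 1<n (i , a , on)
    with ∣p∣<∣q∣⇒∃x∈q∧x∉p ⁅ 0# ⁆ ⊤ (subst₂ _<_ (sym (∣⁅x⁆∣≡1 0#)) (sym (∣⊤∣≡n n)) 1<n)
  ... | d , _ , d∉⁅0⁆ = S-not-full (x∉⁅y⁆⇒x≢y d∉⁅0⁆) i λ x →
    subst (_∈ S i) (//-rightDividesʳ a x) (on ∈⊤)

  ∃-∈-offLine : ∀ {B} → ¬ Collinear B → ∀ i a → ∃ λ y → y ∈ B × ¬ OnLine i a y
  ∃-∈-offLine {B} ¬col i a with ∀∈⊎∃∈¬ (OnLine? i a) B
  ... | inj₁ B-on-line = contradiction (i , a , λ {x} → B-on-line {x}) ¬col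
  ... | inj₂ witness   = witness

  collinear-⊆ : ∀ {B B′} → B ⊆ B′ → Collinear B′ → Collinear B
  collinear-⊆ B⊆B′ (i , a , on) = i , a , on ∘ B⊆B′

  translate⇒collinear : ∀ {B} → (∃₂ λ i T → T ⊆ S i × IsTranslateOf G B T) → Collinear B
  translate⇒collinear {B} (i , T , T⊆Sᵢ , a , B≈T+a) = i , a , on
    where
      on : ∀ {x} → x ∈ B → OnLine i a x
      on {x} x∈B with Equivalence.to (B≈T+a x) x∈B
      ... | t , t∈T , refl = subst (_∈ S i) (sym (//-rightDividesʳ a t)) (T⊆Sᵢ t∈T)

  collinear⇒translate : ∀ {B} → Collinear B → ∃₂ λ i T → T ⊆ S i × IsTranslateOf G B T
  collinear⇒translate {B} (i , a , on) = i , preimage (_+ a) B , T⊆Sᵢ , a , λ x → mk⇔ to from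
    where
      T⊆Sᵢ : preimage (_+ a) B ⊆ S i
      T⊆Sᵢ {t} t∈T = subst (_∈ S i) (//-rightDividesʳ a t) (on (x∈preimage⁻ t∈T))
      to : ∀ {x} → x ∈ B → ∃ λ t → t ∈ preimage (_+ a) B × x ≡ t + a
      to {x} x∈B = x // a , x∈preimage⁺ (subst (_∈ B) x≡[x-a]+a x∈B) , x≡[x-a]+a
        where
          x≡[x-a]+a : x ≡ x // a + a
          x≡[x-a]+a = sym (//-rightDividesˡ a x)
      from : ∀ {x} → (∃ λ t → t ∈ preimage (_+ a) B × x ≡ t + a) → x ∈ B
      from (t , t∈T , refl) = x∈preimage⁻ t∈T

  ¬collinear⇒basis : ∀ {B} → ∣ B ∣ ≡ 3 → ¬ Collinear B → Basis B
  ¬collinear⇒basis ∣B∣≡3 ¬col = ∣B∣≡3 , ¬col ∘ translate⇒collinear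

  basis⇒¬collinear : ∀ {B} → Basis B → ¬ Collinear B
  basis⇒¬collinear (_ , ¬translate) = ¬translate ∘ collinear⇒translate

  ∣translate-⁅x⁆∪⁅y⁆∪⁅z⁆∣≡3 : ∀ {p q r B′} → Distinct₃ p q r →
                            IsTranslateOf G B′ (⁅ p ⁆ ∪ ⁅ q ⁆ ∪ ⁅ r ⁆) → ∣ B′ ∣ ≡ 3
  ∣translate-⁅x⁆∪⁅y⁆∪⁅z⁆∣≡3 {p} {q} {r} {B′} (p≢q , p≢r , q≢r) (c , B′≈T+c) = begin
    ∣ B′ ∣                                ≡⟨ cong ∣_∣ (image-⁅x⁆∪⁅y⁆∪⁅z⁆ (_+ c) B′≈T+c) ⟩
    ∣ ⁅ p + c ⁆ ∪ ⁅ q + c ⁆ ∪ ⁅ r + c ⁆ ∣ ≡⟨ ∣⁅x⁆∪⁅y⁆∪⁅z⁆∣≡3 distinct ⟩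
    3                                     ∎
    where
      distinct : Distinct₃ (p + c) (q + c) (r + c)
      distinct = p≢q ∘ ∙-cancelʳ c p q , p≢r ∘ ∙-cancelʳ c p r , q≢r ∘ ∙-cancelʳ c q r

  ∣translate∣≡3 : ∀ {B B′} → IsTranslateOf G B′ B → ∣ B ∣ ≡ 3 → ∣ B′ ∣ ≡ 3
  ∣translate∣≡3 {B′ = B′} B′-translate ∣B∣≡3 =
    let _ , _ , _ , distinct , B≡T = ∣p∣≡3⇒≡⁅x⁆∪⁅y⁆∪⁅z⁆ ∣B∣≡3 in
    ∣translate-⁅x⁆∪⁅y⁆∪⁅z⁆∣≡3 distinct (subst (IsTranslateOf G B′) B≡T B′-translate)

  translate-collinear : ∀ {B B′} → IsTranslateOf G B′ B → Collinear B′ → Collinear B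
  translate-collinear {B} (c , B′≈B+c) (i , b , on) = i , b // c , on-shifted
    where
      on-shifted : ∀ {x} → x ∈ B → OnLine i (b // c) x
      on-shifted {x} x∈B = subst (_∈ S i) [x+c]-b≡x-[b-c] (on (Equivalence.from (B′≈B+c _) (x , x∈B , refl)))
        where
          [x+c]-b≡x-[b-c] : (x + c) // b ≡ x // (b // c)
          [x+c]-b≡x-[b-c] = begin
            (x + c) // b                ≡⟨ cong ((x + c) //_) (//-rightDividesˡ c b) ⟨
            (x + c) // ((b // c) + c)   ≡⟨ x∙z//y∙z≈x//y (group G) x (b // c) c ⟩
            x // (b // c)               ∎

  on-off⇒≢ : ∀ {i a x y} → OnLine i a x → ¬ OnLine i a y → x ≢ y
  on-off⇒≢ {i} {a} x∈ℓ y∉ℓ x≡y = y∉ℓ (subst (OnLine i a) x≡y x∈ℓ)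

  off-line⇒¬collinear : ∀ {i a p q y} → p ≢ q → OnLine i a p → OnLine i a q → ¬ OnLine i a y →
                        ¬ Collinear (⁅ p ⁆ ∪ ⁅ q ⁆ ∪ ⁅ y ⁆)
  off-line⇒¬collinear p≢q p∈ℓ q∈ℓ y∉ℓ (j , b , on)
    with line-unique p≢q (on x∈⁅x⁆∪⁅y⁆∪⁅z⁆) (on y∈⁅x⁆∪⁅y⁆∪⁅z⁆) p∈ℓ q∈ℓ
  ... | refl , refl = y∉ℓ (on z∈⁅x⁆∪⁅y⁆∪⁅z⁆)

  ∃-noncollinear-extension : ∀ {p q B} → p ≢ q → 3 ≤ ∣ B ∣ → ¬ Collinear B →
    ∃ λ y → y ∈ B × Distinct₃ p q y × ¬ Collinear (⁅ p ⁆ ∪ ⁅ q ⁆ ∪ ⁅ y ⁆)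
  ∃-noncollinear-extension {p} {q} p≢q 3≤∣B∣ ¬col
    with any? (λ i → any? (λ a → OnLine? i a p ×-dec OnLine? i a q))
  ... | yes (i , a , p∈ℓ , q∈ℓ) =
    let y , y∈B , y∉ℓ = ∃-∈-offLine ¬col i a in
    y , y∈B , (p≢q , on-off⇒≢ p∈ℓ y∉ℓ , on-off⇒≢ q∈ℓ y∉ℓ) , off-line⇒¬collinear p≢q p∈ℓ q∈ℓ y∉ℓ
  ... | no no-line-through-p,q =
    let y , y∈B , y≢p , y≢q = ∃-∉⁅x⁆∪⁅y⁆ 3≤∣B∣ p q in
    y , y∈B , (p≢q , ≢-sym y≢p , ≢-sym y≢q) ,
    λ (i , a , on) → no-line-through-p,q (i , a , on x∈⁅x⁆∪⁅y⁆∪⁅z⁆ , on y∈⁅x⁆∪⁅y⁆∪⁅z⁆)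

  exchange : ∀ B₁ B₂ → Basis B₁ → Basis B₂ → ∀ x → x ∈ B₁ → x ∉ B₂ →
             ∃ λ y → y ∈ B₂ × y ∉ B₁ × Basis ((B₁ - x) ∪ ⁅ y ⁆)
  exchange B₁ B₂ (∣B₁∣≡3 , _) B₂-basis x x∈B₁ x∉B₂
    with x∈p∧∣p∣≡3⇒≡⁅x⁆∪⁅y⁆∪⁅z⁆ x∈B₁ ∣B₁∣≡3
  ... | p , q , (x≢p , x≢q , p≢q) , B₁≡⁅x⁆∪⁅p⁆∪⁅q⁆
    with ∃-noncollinear-extension p≢q (≤-reflexive (sym (proj₁ B₂-basis))) (basis⇒¬collinear B₂-basis)
  ... | y , y∈B₂ , distinct@(_ , p≢y , q≢y) , ¬col =
    y , y∈B₂ , y∉B₁ , ¬collinear⇒basis ∣B₁′∣≡3 (¬col ∘ collinear-⊆ ⁅p⁆∪⁅q⁆∪⁅y⁆⊆B₁′)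
    where
      y∉B₁ : y ∉ B₁
      y∉B₁ y∈B₁ with x∈⁅y⁆∪⁅z⁆∪⁅w⁆⁻ x p q (subst (y ∈_) B₁≡⁅x⁆∪⁅p⁆∪⁅q⁆ y∈B₁)
      ... | inj₁ refl        = x∉B₂ y∈B₂
      ... | inj₂ (inj₁ refl) = p≢y refl
      ... | inj₂ (inj₂ refl) = q≢y refl
      B₁′ : Subset n
      B₁′ = (B₁ - x) ∪ ⁅ y ⁆
      ∈B₁′ : ∀ {z} → z ∈ ⁅ x ⁆ ∪ ⁅ p ⁆ ∪ ⁅ q ⁆ → z ≢ x → z ∈ B₁′
      ∈B₁′ z∈ z≢x = x∈p∪q⁺ (inj₁ (x∈p∧x≢y⇒x∈p-y (subst (_ ∈_) (sym B₁≡⁅x⁆∪⁅p⁆∪⁅q⁆) z∈) z≢x))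
      ⁅p⁆∪⁅q⁆∪⁅y⁆⊆B₁′ : ⁅ p ⁆ ∪ ⁅ q ⁆ ∪ ⁅ y ⁆ ⊆ B₁′
      ⁅p⁆∪⁅q⁆∪⁅y⁆⊆B₁′ = ⁅x⁆∪⁅y⁆∪⁅z⁆⊆p (∈B₁′ y∈⁅x⁆∪⁅y⁆∪⁅z⁆ (≢-sym x≢p)) (∈B₁′ z∈⁅x⁆∪⁅y⁆∪⁅z⁆ (≢-sym x≢q))
                                      (x∈p∪q⁺ (inj₂ (x∈⁅x⁆ y)))
      ∣B₁′∣≡3 : ∣ B₁′ ∣ ≡ 3
      ∣B₁′∣≡3 = ≤-antisym (≤-trans (∣p-x∪⁅y⁆∣≤∣p∣ y x∈B₁) (≤-reflexive ∣B₁∣≡3))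
                          (subst (_≤ ∣ B₁′ ∣) (∣⁅x⁆∪⁅y⁆∪⁅z⁆∣≡3 distinct) (p⊆q⇒∣p∣≤∣q∣ ⁅p⁆∪⁅q⁆∪⁅y⁆⊆B₁′))

  invariant : IsInvariant G Basis
  invariant B B′ B-basis B′-translate =
    ¬collinear⇒basis (∣translate∣≡3 B′-translate (proj₁ B-basis))
                     (basis⇒¬collinear B-basis ∘ translate-collinear B′-translate)

  3≤∣⊤∣ : 3 ≤ n → 3 ≤ ∣ ⊤ {n} ∣
  3≤∣⊤∣ = subst (3 ≤_) (sym (∣⊤∣≡n n))

  ∃-basis∋distinct : 3 ≤ n → ∀ {p q} → p ≢ q → ∃ λ B → Basis B × p ∈ B × q ∈ B
  ∃-basis∋distinct 3≤n p≢q
    with ∃-noncollinear-extension p≢q (3≤∣⊤∣ 3≤n) (¬collinear-⊤ (≤-trans (s≤s (s≤s z≤n)) 3≤n))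
  ... | y , _ , distinct , ¬col =
    ⁅ _ ⁆ ∪ ⁅ _ ⁆ ∪ ⁅ y ⁆ , ¬collinear⇒basis (∣⁅x⁆∪⁅y⁆∪⁅z⁆∣≡3 distinct) ¬col , x∈⁅x⁆∪⁅y⁆∪⁅z⁆ , y∈⁅x⁆∪⁅y⁆∪⁅z⁆

  ∃-basis∋ : 3 ≤ n → ∀ p q → ∃ λ B → Basis B × p ∈ B × q ∈ B
  ∃-basis∋ 3≤n p q with p ≟ q
  ... | no p≢q = ∃-basis∋distinct 3≤n p≢q
  ... | yes refl with ∃-∉⁅x⁆∪⁅y⁆ {p = ⊤} (3≤∣⊤∣ 3≤n) p p
  ...   | q′ , _ , q′≢p , _ with ∃-basis∋distinct 3≤n (≢-sym q′≢p)
  ...     | B , B-basis , p∈B , _ = B , B-basis , p∈B , p∈B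

  ∣C∣<3⇒independent : 3 ≤ n → ∀ {C} → ∣ C ∣ < 3 → Independent Basis C
  ∣C∣<3⇒independent 3≤n ∣C∣<3 with ∣p∣<3⇒⊆⁅x⁆∪⁅y⁆ 0# ∣C∣<3
  ... | p , q , C⊆⁅p⁆∪⁅q⁆ with ∃-basis∋ 3≤n p q
  ... | B , B-basis , p∈B , q∈B = B , B-basis , ⊆-trans C⊆⁅p⁆∪⁅q⁆ (⁅x⁆∪p⊆q p∈B (⁅x⁆⊆p q∈B))

  simple : 3 ≤ n → IsSimple Basis
  simple 3≤n C (dependent , _) with 3 ≤? ∣ C ∣
  ... | yes 3≤∣C∣ = 3≤∣C∣
  ... | no  3≰∣C∣ = contradiction (∣C∣<3⇒independent 3≤n (≰⇒> 3≰∣C∣)) dependent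

proposition3p24 : (n : ℕ) → 3 ≤ n → (G : FinAbGroup n) →
    (k : ℕ) → (S : Fin k → Subset n) → IsDDS G S →
    IsMatroidBases (DDSBasis G S) × HasRank (DDSBasis G S) 3
      × IsSimple (DDSBasis G S) × IsInvariant G (DDSBasis G S)
proposition3p24 n 3≤n G k S dds =
  let B₀ , B₀-basis , _ = ∃-basis∋ 3≤n 0# 0# in
  ((B₀ , B₀-basis) , exchange) , (λ _ → proj₁) , simple 3≤n , invariant
  where
    open FinAbGroup G using (0#)
    open DDSMatroid G dds
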